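{- Let $G \in ER(n,d,\lambda)$, and let $x > 0$ and $m > 1$ be integers. Then the $(m,x)$-shadow $D_m^x(G)$ is edge-regular if and only if there exist nonnegative integers $d_x, \lambda_x$ such that the following three conditions hold: (1) for all $v \in V(G)$, $|N^x(v)| = d_x$; (2) for all $u,v \in V(G)$ with $u \sim v$ in $G$, $|N^x(u) \cap N^x(v)| = \lambda_x$; (3) for all $v,w \in V(G)$ with $w \in N^x(v)$, $|N^x(v) \cap N(w)| + |N(v) \cap N^x(w)| + (m-2)|N^x(v) \cap N^x(w)| = \lambda + (m-1)\lambda_x$.
   Context: All graphs are finite and simple. For a vertex $v$ of a graph $G$, $N(v)=N_G(v)$ is its neighborhood, and for a positive integer $x$, $N^x(v)=N^x_G(v)$ is the $x$-distance neighborhood of $v$ in $G$, i.e. the set of vertices at distance exactly $x$ from $v$ in $G$. A graph $G$ is edge-regular if it is regular and there is $\lambda \ge 0$ such that every two adjacent vertices have exactly $\lambda$ common neighbors; $ER(n,d,\lambda)$ denotes the set of edge-regular graphs on $n$ vertices, regular of degree $d$, with this parameter $\lambda$. For $x \ge 1$ and $m \ge 2$, the $(m,x)$-shadow $D_m^x(G)$ is the simple graph whose vertex set is the disjoint union of $m$ copies $G_1,\dots,G_m$ of $G$ (the copy of $u\in V(G)$ in $G_i$ denoted $u_i$), with edges $u_iv_i$ for $1\le i\le m$ and $uv \in E(G)$, and edges $u_iv_j$ for $1 \le i < j \le m$ whenever $u \in N_G^x(v)$. -}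

module Defs where

open import Data.Nat using (ℕ; zero; suc; _∸_; _≤_; _<_)
open import Data.Bool using (Bool; true; false; _∧_; _∨_; not; if_then_else_)
open import Data.Fin using (Fin; _≟_; remQuot) renaming (_<?_ to _<ᶠ?_)
open import Data.Fin.Subset using (Subset; _∩_; ∣_∣)
open import Data.Vec using (tabulate)
open import Data.List using (allFin)
open import Data.Bool.ListAction using (any)
open import Data.Product using (_×_; _,_; ∃-syntax)
open import Relation.Binary.PropositionalEquality using (_≡_)
open import Relation.Nullary.Decidable using (⌊_⌋)

Graph : ℕ → Set
Graph n = Fin n → Fin n → Bool

IsSimple : ∀ {n} → Graph n → Set
IsSimple {n} G = (∀ (u v : Fin n) → G u v ≡ G v u) × (∀ (v : Fin n) → G v v ≡ false)

N : ∀ {n} → Graph n → Fin n → Subset n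
N G v = tabulate (λ u → G v u)

within : ∀ {n} → Graph n → ℕ → Fin n → Fin n → Bool
within {n} G zero    v u = ⌊ v ≟ u ⌋
within {n} G (suc k) v u = within G k v u ∨ any (λ w → within G k v w ∧ G w u) (allFin n)

inNd : ∀ {n} → Graph n → ℕ → Fin n → Fin n → Bool
inNd G x v u = within G x v u ∧ not (within G (x ∸ 1) v u)

-- x-distance neighbourhood N^x(v): vertices u with dist(v,u) = x exactly
-- (used for x ≥ 1: dist ≤ x and not dist ≤ x - 1).
Nd : ∀ {n} → Graph n → ℕ → Fin n → Subset n
Nd G x v = tabulate (λ u → inNd G x v u)

ER : (n d λ' : ℕ) → Graph n → Set
ER n d λ' G =
  (∀ (v : Fin n) → ∣ N G v ∣ ≡ d) ×
  (∀ (u v : Fin n) → G u v ≡ true → ∣ N G u ∩ N G v ∣ ≡ λ')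

EdgeRegular : ∀ {n} → Graph n → Set
EdgeRegular {n} G = ∃[ d ] ∃[ λ' ] ER n d λ' G

-- Vertex set Fin (m * n), where a vertex p
-- encodes the pair (i , u) = remQuot n p, i.e. the copy u_i of u in G_i.
shadow : ∀ {n} (m x : ℕ) → Graph n → Graph (m Data.Nat.* n)
shadow {n} m x G p q with remQuot {m} n p | remQuot {m} n q
... | (i , u) | (j , v) =
  if ⌊ i ≟ j ⌋ then G u v
  else (if ⌊ i <ᶠ? j ⌋ then inNd G x v u else inNd G x u v)

{-# OPTIONS --safe #-}
-- Distance in G is symmetric, so u_i ~ v_j in the shadow iff u ~ v (for i = j) or u ∈ N^x(v)
-- (for i ≠ j). Counting neighbourhoods in the shadow copy by copy, u_i has |N(u)| + (m-1)|N^x(u)|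
-- neighbours; two vertices u_i, v_i of one copy have |N(u) ∩ N(v)| + (m-1)|N^x(u) ∩ N^x(v)|
-- common neighbours; and u_i, v_j with i ≠ j have |N^x(u) ∩ N(v)| + |N(u) ∩ N^x(v)| +
-- (m-2)|N^x(u) ∩ N^x(v)|. Since G is edge-regular and y ↦ a + (m-1)y is injective, constancy of
-- these three counts is exactly conditions (1)-(3).
module Submission where

open import Defs
open import Data.Nat using (ℕ; _+_; _*_; _∸_; _<_)
open import Data.Bool using (true)
open import Data.Fin using (Fin)
open import Data.Fin.Subset using (_∩_; ∣_∣)
open import Data.Product using (_×_; ∃-syntax)
open import Function.Bundles using (_⇔_)
open import Relation.Binary.PropositionalEquality using (_≡_)

open import Data.Bool using (Bool; false; T; _∧_; not; if_then_else_)
import Data.Bool as Bool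
open import Data.Bool.Properties using (T-≡; T-∧; T-∨; T-not-≡)
open import Data.Empty using (⊥-elim)
open import Data.Fin using (zero; suc; _≟_; _↑ˡ_; _↑ʳ_; combine; remQuot; punchIn; punchOut)
  renaming (_<?_ to _<ᶠ?_)
open import Data.Fin.Properties
  using (any?; remQuot-combine; combine-remQuot; punchInᵢ≢i; punchIn-injective; punchIn-punchOut)
open import Data.Fin.Subset using (Subset)
open import Data.List using (allFin)
open import Data.List.Membership.Propositional using (lose)
open import Data.List.Membership.Propositional.Properties using (∈-allFin)
open import Data.List.Relation.Unary.Any using (satisfied)
open import Data.List.Relation.Unary.Any.Properties using (any⁺; any⁻)
open import Data.Nat using (zero; suc; s≤s; z≤n)
open import Data.Nat.Properties using (+-assoc; +-cancelˡ-≡; *-cancelˡ-≡; +-0-commutativeMonoid)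
open import Algebra.Properties.CommutativeMonoid.Sum +-0-commutativeMonoid
  using (sum; sum-syntax; sum-cong-≗; sum-remove)
open import Data.Product using (_,_; proj₁; proj₂; ∃; ∃₂; curry; uncurry)
open import Data.Sum using (_⊎_; inj₁; inj₂)
open import Data.Unit using (⊤; tt)
open import Data.Vec using (tabulate; _∷_)
open import Data.Vec.Properties using (tabulate-cong)
open import Function using (_∘_; Equivalence; mk⇔)
open import Relation.Binary.PropositionalEquality
  using (refl; sym; trans; cong; cong₂; subst; _≢_; module ≡-Reasoning)
open import Relation.Nullary using (Dec; yes; no; ¬_)
open import Relation.Nullary.Decidable
  using (⌊_⌋; isYes≗does; dec-true; dec-false; does-⇔; toWitness; fromWitness; map′)

open Equivalence using (to; from)
open ≡-Reasoning

T-injective : ∀ {a b} → T a ⇔ T b → a ≡ b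
T-injective {false} {false} _ = refl
T-injective {false} {true}  e = ⊥-elim (from e tt)
T-injective {true}  {false} e = ⊥-elim (to e tt)
T-injective {true}  {true}  _ = refl

⌊⌋-true : ∀ {a} {A : Set a} (a? : Dec A) → A → ⌊ a? ⌋ ≡ true
⌊⌋-true a? a = trans (isYes≗does a?) (dec-true a? a)

⌊⌋-false : ∀ {a} {A : Set a} (a? : Dec A) → ¬ A → ⌊ a? ⌋ ≡ false
⌊⌋-false a? ¬a = trans (isYes≗does a?) (dec-false a? ¬a)

⌊⌋-⇔ : ∀ {a b} {A : Set a} {B : Set b} → A ⇔ B → (a? : Dec A) (b? : Dec B) → ⌊ a? ⌋ ≡ ⌊ b? ⌋
⌊⌋-⇔ A⇔B a? b? = trans (isYes≗does a?) (trans (does-⇔ A⇔B a? b?) (sym (isYes≗does b?)))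

affine-injective : ∀ b s {y z} → b + suc s * y ≡ b + suc s * z → y ≡ z
affine-injective b s {y} {z} e = *-cancelˡ-≡ y z (suc s) (+-cancelˡ-≡ b _ _ e)

∃-common-value : ∀ {a p} {A : Set a} {P : A → Set p} (f : A → ℕ) → Dec (∃ P) →
  (∀ x y → P x → P y → f x ≡ f y) → ∃[ c ] (∀ x → P x → f x ≡ c)
∃-common-value f (yes (x₀ , px₀)) same = f x₀ , λ x px → same x x₀ px px₀
∃-common-value f (no ¬∃P)         _    = 0 , λ x px → ⊥-elim (¬∃P (x , px))

indicator : Bool → ℕ
indicator true  = 1
indicator false = 0

∑-const : ∀ n c → ∑[ i < n ] c ≡ n * c
∑-const zero    c = refl
∑-const (suc n) c = cong (c +_) (∑-const n c)

∑-↑ : ∀ a b (f : Fin (a + b) → ℕ) → sum f ≡ ∑[ i < a ] f (i ↑ˡ b) + ∑[ j < b ] f (a ↑ʳ j)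
∑-↑ zero    b f = refl
∑-↑ (suc a) b f = trans (cong (f zero +_) (∑-↑ a b (f ∘ suc))) (sym (+-assoc (f zero) _ _))

∑-combine : ∀ m n (f : Fin (m * n) → ℕ) → sum f ≡ ∑[ k < m ] ∑[ w < n ] f (combine k w)
∑-combine zero    n f = refl
∑-combine (suc m) n f =
  trans (∑-↑ n (m * n) f) (cong (∑[ w < n ] f (w ↑ˡ m * n) +_) (∑-combine m n (f ∘ (n ↑ʳ_))))

∑-≟ : ∀ {m} (i : Fin (suc m)) (f : Bool → ℕ) → ∑[ k < suc m ] f ⌊ i ≟ k ⌋ ≡ f true + m * f false
∑-≟ {m} i f = begin
  ∑[ k < suc m ] f ⌊ i ≟ k ⌋                       ≡⟨ sum-remove {i = i} (λ k → f ⌊ i ≟ k ⌋) ⟩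
  f ⌊ i ≟ i ⌋ + ∑[ k < m ] f ⌊ i ≟ punchIn i k ⌋
    ≡⟨ cong₂ _+_ (cong f (⌊⌋-true (i ≟ i) refl))
                 (sum-cong-≗ λ k → cong f (⌊⌋-false (i ≟ punchIn i k) (punchInᵢ≢i i k ∘ sym))) ⟩
  f true + ∑[ k < m ] f false                      ≡⟨ cong (f true +_) (∑-const m (f false)) ⟩
  f true + m * f false                             ∎

∑-≟-≟ : ∀ {m} {i j : Fin (suc (suc m))} → i ≢ j → (f : Bool → Bool → ℕ) →
  ∑[ k < suc (suc m) ] f ⌊ i ≟ k ⌋ ⌊ j ≟ k ⌋ ≡ f true false + f false true + m * f false false
∑-≟-≟ {m} {i} {j} i≢j f = begin
  ∑[ k < suc (suc m) ] f ⌊ i ≟ k ⌋ ⌊ j ≟ k ⌋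
    ≡⟨ sum-remove {i = i} (λ k → f ⌊ i ≟ k ⌋ ⌊ j ≟ k ⌋) ⟩
  f ⌊ i ≟ i ⌋ ⌊ j ≟ i ⌋ + ∑[ k < suc m ] f ⌊ i ≟ punchIn i k ⌋ ⌊ j ≟ punchIn i k ⌋
    ≡⟨ cong₂ _+_ (cong₂ f (⌊⌋-true (i ≟ i) refl) (⌊⌋-false (j ≟ i) (i≢j ∘ sym)))
                 (sum-cong-≗ λ k → cong₂ f (⌊⌋-false (i ≟ punchIn i k) (punchInᵢ≢i i k ∘ sym))
                                           (⌊⌋-⇔ (removed k) (j ≟ punchIn i k) (j′ ≟ k))) ⟩
  f true false + ∑[ k < suc m ] f false ⌊ j′ ≟ k ⌋
    ≡⟨ cong (f true false +_) (∑-≟ j′ (f false)) ⟩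
  f true false + (f false true + m * f false false)
    ≡⟨ sym (+-assoc (f true false) _ _) ⟩
  f true false + f false true + m * f false false ∎
  where
  j′ = punchOut i≢j
  removed : ∀ k → (j ≡ punchIn i k) ⇔ (j′ ≡ k)
  removed k = mk⇔ (λ j≡ → punchIn-injective i j′ k (trans (punchIn-punchOut i≢j) j≡))
                  (λ j′≡ → trans (sym (punchIn-punchOut i≢j)) (cong (punchIn i) j′≡))

∣tabulate∣≡∑ : ∀ {n} (h : Fin n → Bool) → ∣ tabulate h ∣ ≡ ∑[ w < n ] indicator (h w)
∣tabulate∣≡∑ {zero}  h = refl
∣tabulate∣≡∑ {suc n} h with h zero
... | true  = cong suc (∣tabulate∣≡∑ (h ∘ suc))
... | false = ∣tabulate∣≡∑ (h ∘ suc)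

∣tabulate∣-combine : ∀ {m n} (h : Fin (m * n) → Bool) →
  ∣ tabulate h ∣ ≡ ∑[ k < m ] ∣ tabulate (h ∘ combine {n = n} k) ∣
∣tabulate∣-combine {m} {n} h =
  trans (∣tabulate∣≡∑ h)
    (trans (∑-combine m n _) (sum-cong-≗ {m} λ k → sym (∣tabulate∣≡∑ (h ∘ combine {n = n} k))))

tabulate-∩ : ∀ {n} (f g : Fin n → Bool) → tabulate f ∩ tabulate g ≡ tabulate (λ w → f w ∧ g w)
tabulate-∩ {zero}  f g = refl
tabulate-∩ {suc n} f g = cong (f zero ∧ g zero ∷_) (tabulate-∩ (f ∘ suc) (g ∘ suc))

combine-elim : ∀ {p m n} (P : Fin (m * n) → Set p) → (∀ i u → P (combine i u)) → ∀ q → P q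
combine-elim {m = m} {n} P P-combine q =
  subst P (combine-remQuot {m} n q) (uncurry P-combine (remQuot {m} n q))

module _ {n} (G : Graph n) where

  within-weaken : ∀ k {v u} → T (within G k v u) → T (within G (suc k) v u)
  within-weaken k p = from T-∨ (inj₁ p)

  within-extend : ∀ k {v w u} → T (within G k v w) → T (G w u) → T (within G (suc k) v u)
  within-extend k {w = w} p g = from T-∨ (inj₂ (any⁺ _ (lose (∈-allFin w) (from T-∧ (p , g)))))

  within-suc⁻ : ∀ k {v u} → T (within G (suc k) v u) →
    T (within G k v u) ⊎ ∃[ w ] (T (within G k v w) × T (G w u))
  within-suc⁻ k p with to T-∨ p
  ... | inj₁ q = inj₁ q
  ... | inj₂ q with satisfied (any⁻ _ (allFin n) q)
  ...   | w , r = inj₂ (w , to T-∧ r)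

  within-cons : ∀ k {v w u} → T (G v w) → T (within G k w u) → T (within G (suc k) v u)
  within-cons zero g p with toWitness p
  ... | refl = within-extend zero (fromWitness refl) g
  within-cons (suc k) g p with within-suc⁻ k p
  ... | inj₁ q             = within-weaken (suc k) (within-cons k g q)
  ... | inj₂ (w , q , g′) = within-extend (suc k) (within-cons k g q) g′

  inNd⇒edge : ∀ k {v u} → inNd G (suc k) v u ≡ true → ∃₂ λ a b → G a b ≡ true
  inNd⇒edge k e with to T-∧ (from T-≡ e)
  ... | p , ¬q with within-suc⁻ k p
  ...   | inj₁ q             = ⊥-elim (subst T (to T-not-≡ ¬q) q)
  ...   | inj₂ (w , _ , g) = w , _ , to T-≡ g

module _ {n} (G : Graph n) (G-sym : ∀ u v → G u v ≡ G v u) where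

  within-sym : ∀ k {v u} → T (within G k v u) → T (within G k u v)
  within-sym zero p with toWitness p
  ... | refl = p
  within-sym (suc k) p with within-suc⁻ G k p
  ... | inj₁ q            = within-weaken G k (within-sym k q)
  ... | inj₂ (w , q , g) = within-cons G k (subst T (G-sym _ _) g) (within-sym k q)

  inNd-comm : ∀ x v u → inNd G x v u ≡ inNd G x u v
  inNd-comm x v u = cong₂ (λ a b → a ∧ not b) (within-comm x) (within-comm (x ∸ 1))
    where
    within-comm : ∀ k → within G k v u ≡ within G k u v
    within-comm k = T-injective (mk⇔ (within-sym k) (within-sym k))

module _ {n} (G : Graph n) (G-sym : ∀ u v → G u v ≡ G v u) (x : ℕ) where

  -- The flag records whether a copy G_k is the own copy G_i of the vertex u_i (see shadow-row).
  layer : Bool → Fin n → Subset n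
  layer true  = N G
  layer false = Nd G x

  shadow-combine : ∀ {m} (i : Fin m) u j v →
    shadow m x G (combine i u) (combine j v) ≡ (if ⌊ i ≟ j ⌋ then G u v else inNd G x u v)
  shadow-combine {m} i u j v =
    trans (cong₂ adjacency (remQuot-combine i u) (remQuot-combine j v))
          (symmetrise ⌊ i ≟ j ⌋ ⌊ i <ᶠ? j ⌋)
    where
    -- shadow p q is definitionally adjacency (remQuot n p) (remQuot n q), so remQuot-combine applies.
    adjacency : Fin m × Fin n → Fin m × Fin n → Bool
    adjacency (i , u) (j , v) =
      if ⌊ i ≟ j ⌋ then G u v else (if ⌊ i <ᶠ? j ⌋ then inNd G x v u else inNd G x u v)
    symmetrise : ∀ b c → (if b then G u v else (if c then inNd G x v u else inNd G x u v))
                         ≡ (if b then G u v else inNd G x u v)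
    symmetrise true  _     = refl
    symmetrise false true  = inNd-comm G G-sym x v u
    symmetrise false false = refl

  shadow-within-copy : ∀ {m} (i : Fin m) u v → shadow m x G (combine i u) (combine i v) ≡ G u v
  shadow-within-copy i u v =
    trans (shadow-combine i u i v) (cong (if_then G u v else inNd G x u v) (⌊⌋-true (i ≟ i) refl))

  shadow-across-copies : ∀ {m} {i j : Fin m} → i ≢ j → ∀ u v →
    shadow m x G (combine i u) (combine j v) ≡ inNd G x u v
  shadow-across-copies {i = i} {j} i≢j u v =
    trans (shadow-combine i u j v) (cong (if_then G u v else inNd G x u v) (⌊⌋-false (i ≟ j) i≢j))

  shadow-adjacent : ∀ {m} (i j : Fin m) u v → shadow m x G (combine i u) (combine j v) ≡ true →
    (i ≡ j × G u v ≡ true) ⊎ (i ≢ j × inNd G x u v ≡ true)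
  shadow-adjacent i j u v e with i ≟ j
  ... | yes refl = inj₁ (refl , trans (sym (shadow-within-copy i u v)) e)
  ... | no i≢j   = inj₂ (i≢j , trans (sym (shadow-across-copies i≢j u v)) e)

  shadow-row : ∀ {m} (i : Fin m) u k →
    tabulate (shadow m x G (combine i u) ∘ combine k) ≡ layer ⌊ i ≟ k ⌋ u
  shadow-row i u k = trans (tabulate-cong (shadow-combine i u k)) (tabulate-if ⌊ i ≟ k ⌋)
    where
    tabulate-if : ∀ b → tabulate (λ w → if b then G u w else inNd G x u w) ≡ layer b u
    tabulate-if true  = refl
    tabulate-if false = refl

  ∣N∣-shadow : ∀ {m} (i : Fin m) u →
    ∣ N (shadow m x G) (combine i u) ∣ ≡ ∑[ k < m ] ∣ layer ⌊ i ≟ k ⌋ u ∣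
  ∣N∣-shadow {m} i u =
    trans (∣tabulate∣-combine {m} _) (sum-cong-≗ {m} λ k → cong ∣_∣ (shadow-row i u k))

  ∣N∩N∣-shadow : ∀ {m} (i : Fin m) u j v →
    ∣ N (shadow m x G) (combine i u) ∩ N (shadow m x G) (combine j v) ∣
      ≡ ∑[ k < m ] ∣ layer ⌊ i ≟ k ⌋ u ∩ layer ⌊ j ≟ k ⌋ v ∣
  ∣N∩N∣-shadow {m} i u j v = begin
    ∣ tabulate Aᵢᵤ ∩ tabulate Aⱼᵥ ∣                   ≡⟨ cong ∣_∣ (tabulate-∩ Aᵢᵤ Aⱼᵥ) ⟩
    ∣ tabulate (λ r → Aᵢᵤ r ∧ Aⱼᵥ r) ∣                ≡⟨ ∣tabulate∣-combine {m} _ ⟩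
    ∑[ k < m ] ∣ tabulate (λ w → Aᵢᵤ (combine k w) ∧ Aⱼᵥ (combine k w)) ∣
      ≡⟨ sum-cong-≗ {m} (λ k → cong ∣_∣ (trans (sym (tabulate-∩ _ _))
                                               (cong₂ _∩_ (shadow-row i u k) (shadow-row j v k)))) ⟩
    ∑[ k < m ] ∣ layer ⌊ i ≟ k ⌋ u ∩ layer ⌊ j ≟ k ⌋ v ∣ ∎
    where
    Aᵢᵤ Aⱼᵥ : Fin (m * n) → Bool
    Aᵢᵤ = shadow m x G (combine i u)
    Aⱼᵥ = shadow m x G (combine j v)

  degree-shadow : ∀ {m} (i : Fin (suc m)) u →
    ∣ N (shadow (suc m) x G) (combine i u) ∣ ≡ ∣ N G u ∣ + m * ∣ Nd G x u ∣
  degree-shadow i u = trans (∣N∣-shadow i u) (∑-≟ i λ b → ∣ layer b u ∣)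

  common-shadow-within-copy : ∀ {m} (i : Fin (suc m)) u v →
    ∣ N (shadow (suc m) x G) (combine i u) ∩ N (shadow (suc m) x G) (combine i v) ∣
      ≡ ∣ N G u ∩ N G v ∣ + m * ∣ Nd G x u ∩ Nd G x v ∣
  common-shadow-within-copy i u v =
    trans (∣N∩N∣-shadow i u i v) (∑-≟ i λ b → ∣ layer b u ∩ layer b v ∣)

  common-shadow-across-copies : ∀ {m} {i j : Fin (suc (suc m))} → i ≢ j → ∀ u v →
    ∣ N (shadow (suc (suc m)) x G) (combine i u) ∩ N (shadow (suc (suc m)) x G) (combine j v) ∣
      ≡ ∣ Nd G x u ∩ N G v ∣ + ∣ N G u ∩ Nd G x v ∣ + m * ∣ Nd G x u ∩ Nd G x v ∣
  common-shadow-across-copies {i = i} {j} i≢j u v =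
    trans (∣N∩N∣-shadow i u j v) (∑-≟-≟ (i≢j ∘ sym) λ b b′ → ∣ layer b′ u ∩ layer b v ∣)

ShadowConditions : ∀ {n} → Graph n → (λ' x m : ℕ) → Set
ShadowConditions {n} G λ' x m = ∃[ dx ] ∃[ λx ]
  ((∀ (v : Fin n) → ∣ Nd G x v ∣ ≡ dx) ×
   (∀ (u v : Fin n) → G u v ≡ true → ∣ Nd G x u ∩ Nd G x v ∣ ≡ λx) ×
   (∀ (v w : Fin n) → inNd G x v w ≡ true →
      ∣ Nd G x v ∩ N G w ∣ + ∣ N G v ∩ Nd G x w ∣ + (m ∸ 2) * ∣ Nd G x v ∩ Nd G x w ∣
        ≡ λ' + (m ∸ 1) * λx))

module _ {n d λ'} {G : Graph n} (G-sym : ∀ u v → G u v ≡ G v u)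
         (deg-G : ∀ v → ∣ N G v ∣ ≡ d) (λ-G : ∀ u v → G u v ≡ true → ∣ N G u ∩ N G v ∣ ≡ λ')
         (m : ℕ) where

  shadow-edgeRegular : ∀ x → ShadowConditions G λ' x (suc (suc m)) →
    EdgeRegular (shadow (suc (suc m)) x G)
  shadow-edgeRegular x (dx , λx , ∣Nd∣≡dx , ∣Nd∩Nd∣≡λx , across) =
    d + suc m * dx , λ' + suc m * λx , regular , common
    where
    S = shadow (suc (suc m)) x G
    regular : ∀ p → ∣ N S p ∣ ≡ d + suc m * dx
    regular = combine-elim _ λ i u →
      trans (degree-shadow G G-sym x i u) (cong₂ (λ a b → a + suc m * b) (deg-G u) (∣Nd∣≡dx u))
    common-combine : ∀ i u j v → S (combine i u) (combine j v) ≡ true →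
      ∣ N S (combine i u) ∩ N S (combine j v) ∣ ≡ λ' + suc m * λx
    common-combine i u j v e with shadow-adjacent G G-sym x i j u v e
    ... | inj₁ (refl , g) = trans (common-shadow-within-copy G G-sym x i u v)
                                  (cong₂ (λ a b → a + suc m * b) (λ-G u v g) (∣Nd∩Nd∣≡λx u v g))
    ... | inj₂ (i≢j , h)  = trans (common-shadow-across-copies G G-sym x i≢j u v) (across u v h)
    common : ∀ p q → S p q ≡ true → ∣ N S p ∩ N S q ∣ ≡ λ' + suc m * λx
    common = combine-elim _ λ i u → combine-elim _ (common-combine i u)

  module FromEdgeRegularShadow (x D Λ : ℕ)
           (S-er : ER (suc (suc m) * n) D Λ (shadow (suc (suc m)) (suc x) G)) where

    private
      S = shadow (suc (suc m)) (suc x) G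
      deg-S = proj₁ S-er
      λ-S = proj₂ S-er
      copy₀ copy₁ : Fin n → Fin (suc (suc m) * n)
      copy₀ = combine {suc (suc m)} zero
      copy₁ = combine {suc (suc m)} (suc zero)

    degree-determines-∣Nd∣ : ∀ v → d + suc m * ∣ Nd G (suc x) v ∣ ≡ D
    degree-determines-∣Nd∣ v = begin
      d + suc m * ∣ Nd G (suc x) v ∣          ≡⟨ cong (_+ _) (deg-G v) ⟨
      ∣ N G v ∣ + suc m * ∣ Nd G (suc x) v ∣  ≡⟨ degree-shadow G G-sym (suc x) {suc m} zero v ⟨
      ∣ N S (copy₀ v) ∣                       ≡⟨ deg-S (copy₀ v) ⟩
      D                                       ∎

    edge-determines-∣Nd∩Nd∣ : ∀ u v → G u v ≡ true →
      λ' + suc m * ∣ Nd G (suc x) u ∩ Nd G (suc x) v ∣ ≡ Λ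
    edge-determines-∣Nd∩Nd∣ u v g = begin
      λ' + suc m * ∣ Nd G (suc x) u ∩ Nd G (suc x) v ∣
        ≡⟨ cong (_+ _) (λ-G u v g) ⟨
      ∣ N G u ∩ N G v ∣ + suc m * ∣ Nd G (suc x) u ∩ Nd G (suc x) v ∣
        ≡⟨ common-shadow-within-copy G G-sym (suc x) {suc m} zero u v ⟨
      ∣ N S (copy₀ u) ∩ N S (copy₀ v) ∣
        ≡⟨ λ-S (copy₀ u) (copy₀ v) (trans (shadow-within-copy G G-sym (suc x) zero u v) g) ⟩
      Λ ∎

    common-at-distance-x : ∀ v w → inNd G (suc x) v w ≡ true →
      ∣ Nd G (suc x) v ∩ N G w ∣ + ∣ N G v ∩ Nd G (suc x) w ∣ + m * ∣ Nd G (suc x) v ∩ Nd G (suc x) w ∣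
        ≡ Λ
    common-at-distance-x v w h = begin
      ∣ Nd G (suc x) v ∩ N G w ∣ + ∣ N G v ∩ Nd G (suc x) w ∣ + m * ∣ Nd G (suc x) v ∩ Nd G (suc x) w ∣
        ≡⟨ common-shadow-across-copies G G-sym (suc x) 0≢1 v w ⟨
      ∣ N S (copy₀ v) ∩ N S (copy₁ w) ∣
        ≡⟨ λ-S (copy₀ v) (copy₁ w) (trans (shadow-across-copies G G-sym (suc x) 0≢1 v w) h) ⟩
      Λ ∎
      where
      0≢1 : zero ≢ suc {suc m} zero
      0≢1 ()

  shadow-edgeRegular⁻¹ : ∀ x → EdgeRegular (shadow (suc (suc m)) (suc x) G) →
    ShadowConditions G λ' (suc x) (suc (suc m))
  shadow-edgeRegular⁻¹ x (D , Λ , S-er) =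
    proj₁ dx-spec , proj₁ λx-spec , (λ v → proj₂ dx-spec v tt) , curry (proj₂ λx-spec) , across
    where
    open FromEdgeRegularShadow x D Λ S-er
    has-edge? : Dec (∃ λ (e : Fin n × Fin n) → uncurry G e ≡ true)
    has-edge? = map′ (λ (u , v , g) → (u , v) , g) (λ ((u , v) , g) → u , v , g)
                     (any? λ u → any? λ v → G u v Bool.≟ true)
    dx-spec : ∃[ c ] (∀ v → ⊤ → ∣ Nd G (suc x) v ∣ ≡ c)
    dx-spec = ∃-common-value _ (any? λ _ → yes tt) λ v w _ _ →
      affine-injective d m (trans (degree-determines-∣Nd∣ v)
                                  (sym (degree-determines-∣Nd∣ w)))
    -- λx is read off any edge of G; with no edge, a vertex at distance x ≥ 1 cannot exist either.
    λx-spec : ∃[ c ] (∀ e → uncurry G e ≡ true →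
                        uncurry (λ u v → ∣ Nd G (suc x) u ∩ Nd G (suc x) v ∣) e ≡ c)
    λx-spec = ∃-common-value _ has-edge? λ (u , v) (u′ , v′) g g′ →
      affine-injective λ' m (trans (edge-determines-∣Nd∩Nd∣ u v g)
                                   (sym (edge-determines-∣Nd∩Nd∣ u′ v′ g′)))
    Λ-value : ∃₂ (λ a b → G a b ≡ true) → Λ ≡ λ' + suc m * proj₁ λx-spec
    Λ-value (a , b , g) = trans (sym (edge-determines-∣Nd∩Nd∣ a b g))
                                (cong (λ c → λ' + suc m * c) (proj₂ λx-spec (a , b) g))
    across : ∀ v w → inNd G (suc x) v w ≡ true →
      ∣ Nd G (suc x) v ∩ N G w ∣ + ∣ N G v ∩ Nd G (suc x) w ∣ + m * ∣ Nd G (suc x) v ∩ Nd G (suc x) w ∣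
        ≡ λ' + suc m * proj₁ λx-spec
    across v w h = trans (common-at-distance-x v w h) (Λ-value (inNd⇒edge G x h))

theorem2p2 : (n d λ' : ℕ) (G : Graph n) → IsSimple G → ER n d λ' G →
    (x m : ℕ) → 0 < x → 1 < m →
    EdgeRegular (shadow m x G) ⇔
      (∃[ dx ] ∃[ λx ]
        ((∀ (v : Fin n) → ∣ Nd G x v ∣ ≡ dx) ×
         (∀ (u v : Fin n) → G u v ≡ true → ∣ Nd G x u ∩ Nd G x v ∣ ≡ λx) ×
         (∀ (v w : Fin n) → inNd G x v w ≡ true →
            ∣ Nd G x v ∩ N G w ∣ + ∣ N G v ∩ Nd G x w ∣ + (m ∸ 2) * ∣ Nd G x v ∩ Nd G x w ∣
              ≡ λ' + (m ∸ 1) * λx)))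
theorem2p2 n d λ' G (G-sym , _) (deg-G , λ-G) (suc x) (suc (suc m)) (s≤s z≤n) (s≤s (s≤s z≤n)) =
  mk⇔ (shadow-edgeRegular⁻¹ G-sym deg-G λ-G m x) (shadow-edgeRegular G-sym deg-G λ-G m (suc x))
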